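{- Let $\Delta,\Delta'\subseteq\mathbb{R}^d$ be lattice simplices with a vertex at the origin such that $\Gamma^\intercal_\Delta\subseteq\Gamma^\intercal_{\Delta'}\subseteq\mathbb{Z}^d$. If $\Delta$ is empty, then $\Delta'$ is empty as well.
   Context: A lattice simplex in $\mathbb{R}^d$ is the convex hull of $d+1$ affinely independent points of $\mathbb{Z}^d$; it is empty if its only points in $\mathbb{Z}^d$ are its vertices. For a lattice simplex with a vertex at the origin written $\Delta=AS_d$, where $S_d=\operatorname{conv}\{\mathbf{0},e_1,\ldots,e_d\}$ and $A\in\mathbb{Z}^{d\times d}$ is invertible with columns the nonzero vertices, $\Gamma^\intercal_\Delta:=A^\intercal\mathbb{Z}^d$ is the lattice spanned by the rows of $A$. -}

module Defs where

open import Data.Nat using (ℕ; zero; suc)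
open import Data.Fin using (Fin; zero; suc)
open import Data.Integer as ℤ using (ℤ)
open import Data.Rational as ℚ using (ℚ; 0ℚ; 1ℚ)
open import Data.Product using (Σ; ∃; _×_; _,_)
open import Data.Sum using (_⊎_)
open import Relation.Binary.PropositionalEquality using (_≡_)

-- Vectors in ℤ^d / ℚ^d as functions Fin d → _;
-- d×d matrices as functions (row) → (column) → ℤ.
Vecℤ : ℕ → Set
Vecℤ d = Fin d → ℤ

Vecℚ : ℕ → Set
Vecℚ d = Fin d → ℚ

Matℤ : ℕ → Set
Matℤ d = Fin d → Fin d → ℤ

sumℤ : ∀ {d} → (Fin d → ℤ) → ℤ
sumℤ {zero}  f = ℤ.+ 0
sumℤ {suc d} f = f zero ℤ.+ sumℤ (λ i → f (suc i))

sumℚ : ∀ {d} → (Fin d → ℚ) → ℚ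
sumℚ {zero}  f = 0ℚ
sumℚ {suc d} f = f zero ℚ.+ sumℚ (λ i → f (suc i))

toℚ : ℤ → ℚ
toℚ z = z ℚ./ 1

-- the j-th column of A (the j-th nonzero vertex of Δ = A S_d)
column : ∀ {d} → Matℤ d → Fin d → Vecℤ d
column A j i = A i j

transpose : ∀ {d} → Matℤ d → Matℤ d
transpose A i j = A j i

_·ℤ_ : ∀ {d} → Matℤ d → Vecℤ d → Vecℤ d
(A ·ℤ y) i = sumℤ (λ j → A i j ℤ.* y j)

_·ℚ_ : ∀ {d} → Matℤ d → Vecℚ d → Vecℚ d
(A ·ℚ λv) i = sumℚ (λ j → toℚ (A i j) ℚ.* λv j)

-- A is invertible (over ℚ): its columns are linearly independent,
-- i.e. the vertices 0, Ae_1, …, Ae_d are affinely independent.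
Invertible : ∀ {d} → Matℤ d → Set
Invertible {d} A = (c : Vecℚ d) → (∀ i → (A ·ℚ c) i ≡ 0ℚ) → ∀ j → c j ≡ 0ℚ

-- x lies in Δ = A S_d = conv{0, Ae_1, …, Ae_d}:
-- x = Σ_j λ_j (A e_j) with λ_j ≥ 0 and Σ_j λ_j ≤ 1
-- (the coefficient of the vertex 0 being 1 - Σ_j λ_j).
InSimplex : ∀ {d} → Matℤ d → Vecℚ d → Set
InSimplex {d} A x =
  Σ (Vecℚ d) λ λv → (∀ j → 0ℚ ℚ.≤ λv j) × (sumℚ λv ℚ.≤ 1ℚ) × (∀ i → (A ·ℚ λv) i ≡ x i)

IsVertex : ∀ {d} → Matℤ d → Vecℤ d → Set
IsVertex {d} A x = (∀ i → x i ≡ ℤ.+ 0) ⊎ (Σ (Fin d) λ j → ∀ i → x i ≡ A i j)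

Empty : ∀ {d} → Matℤ d → Set
Empty {d} A = (x : Vecℤ d) → InSimplex A (λ i → toℚ (x i)) → IsVertex A x

-- Γᵀ_Δ = Aᵀ ℤ^d (the lattice spanned by the rows of A)
InDualLattice : ∀ {d} → Matℤ d → Vecℤ d → Set
InDualLattice {d} A v = Σ (Vecℤ d) λ y → ∀ i → (transpose A ·ℤ y) i ≡ v i

_⊆Γ_ : ∀ {d} → Matℤ d → Matℤ d → Set
_⊆Γ_ {d} A A' = (v : Vecℤ d) → InDualLattice A v → InDualLattice A' v

-- If A = M A' for an integer matrix M (which is what Γᵀ_Δ ⊆ Γᵀ_Δ' says: every row of A is
-- an integer combination of rows of A'), then M maps a lattice point x = A'λ of Δ' to the
-- lattice point Mx = Aλ of Δ with the same barycentric coefficients λ. As Δ is empty, Mx is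
-- a vertex Ae_j or 0 of Δ, and injectivity of A forces λ = e_j or λ = 0, so x is a vertex of Δ'.
module Submission where

open import Level using (Level; _⊔_)
open import Algebra using (CommutativeRing)
open import Data.Nat using (ℕ; zero; suc)
open import Data.Fin using (Fin; zero; suc)
open import Data.Vec.Functional using (Vector; replicate)
open import Data.Integer as ℤ using (ℤ)
import Data.Integer.Properties as ℤP
open import Data.Rational as ℚ using (ℚ; 0ℚ; mkℚ; ↥_)
import Data.Rational.Properties as ℚP
open import Data.Nat.Coprimality using (1-coprimeTo) renaming (sym to coprime-sym)
open import Data.Product using (Σ; _,_; proj₁; proj₂)
open import Data.Sum using (_⊎_; inj₁; inj₂)

module MatrixAlgebra {c ℓ : Level} (R : CommutativeRing c ℓ) where
  open CommutativeRing R hiding (zero)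
  open import Algebra.Properties.Semiring.Sum semiring public
  open import Algebra.Properties.Ring ring using (-1*x≈-x; x[y-z]≈xy-xz)
  open import Algebra.Properties.Group +-group using (x∙y⁻¹≈ε⇒x≈y; x≈y⇒x∙y⁻¹≈ε)
  open import Relation.Binary.Reasoning.Setoid setoid

  private
    variable
      m n p : ℕ

  Matrix : ℕ → ℕ → Set c
  Matrix m n = Fin m → Fin n → Carrier

  infixr 7 _⊛_
  infixl 8 _⊗_

  _⊛_ : Matrix m n → Vector Carrier n → Vector Carrier m
  (B ⊛ v) i = sum (λ j → B i j * v j)

  _⊗_ : Matrix m n → Matrix n p → Matrix m p
  (B ⊗ C) i k = sum (λ j → B i j * C j k)

  unit : Fin n → Vector Carrier n
  unit zero    zero    = 1#
  unit zero    (suc _) = 0#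
  unit (suc _) zero    = 0#
  unit (suc j) (suc k) = unit j k

  StandardVertex : Vector Carrier n → Set ℓ
  StandardVertex {n} λv = (∀ j → λv j ≈ 0#) ⊎ Σ (Fin n) λ j → ∀ k → λv k ≈ unit j k

  TrivialKernel : Matrix m n → Set (c ⊔ ℓ)
  TrivialKernel B = ∀ v → (∀ i → (B ⊛ v) i ≈ 0#) → ∀ j → v j ≈ 0#

  ∑-zero : ∀ {n} (f : Vector Carrier n) → (∀ k → f k ≈ 0#) → ∑[ k < n ] f k ≈ 0#
  ∑-zero {n} f f≈0 = trans (sum-cong-≋ f≈0) (sum-replicate-zero n)

  ∑-neg : ∀ {n} (f : Vector Carrier n) → ∑[ k < n ] (- f k) ≈ - sum f
  ∑-neg f = begin
    sum (λ k → - f k)       ≈⟨ sum-cong-≋ (λ k → sym (-1*x≈-x (f k))) ⟩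
    sum (λ k → - 1# * f k)  ≈⟨ *-distribˡ-sum (- 1#) f ⟨
    - 1# * sum f            ≈⟨ -1*x≈-x (sum f) ⟩
    - sum f                 ∎

  ∑-*-unit : ∀ {n} (v : Vector Carrier n) j → ∑[ k < n ] (v k * unit j k) ≈ v j
  ∑-*-unit v zero = begin
    v zero * 1# + sum (λ k → v (suc k) * 0#)
      ≈⟨ +-cong (*-identityʳ _) (∑-zero _ (λ k → zeroʳ (v (suc k)))) ⟩
    v zero + 0#  ≈⟨ +-identityʳ _ ⟩
    v zero       ∎
  ∑-*-unit v (suc j) = begin
    v zero * 0# + sum (λ k → v (suc k) * unit j k)
      ≈⟨ +-cong (zeroʳ _) (∑-*-unit (λ k → v (suc k)) j) ⟩
    0# + v (suc j)  ≈⟨ +-identityˡ _ ⟩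
    v (suc j)       ∎

  ⊛-congˡ : (B C : Matrix m n) → (∀ i j → B i j ≈ C i j) → (v : Vector Carrier n) →
            ∀ i → (B ⊛ v) i ≈ (C ⊛ v) i
  ⊛-congˡ B C B≈C v i = sum-cong-≋ (λ j → *-congʳ (B≈C i j))

  ⊛-congʳ : (B : Matrix m n) {u v : Vector Carrier n} → (∀ j → u j ≈ v j) →
            ∀ i → (B ⊛ u) i ≈ (B ⊛ v) i
  ⊛-congʳ B u≈v i = sum-cong-≋ (λ j → *-congˡ (u≈v j))

  ⊛-zeroʳ : (B : Matrix m n) → ∀ i → (B ⊛ replicate n 0#) i ≈ 0#
  ⊛-zeroʳ B i = ∑-zero _ (λ j → zeroʳ (B i j))

  ⊛-unit : (B : Matrix m n) (j : Fin n) → ∀ i → (B ⊛ unit j) i ≈ B i j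
  ⊛-unit B j i = ∑-*-unit (B i) j

  ⊛-distrib-- : (B : Matrix m n) (u v : Vector Carrier n) →
                ∀ i → (B ⊛ (λ j → u j - v j)) i ≈ (B ⊛ u) i - (B ⊛ v) i
  ⊛-distrib-- B u v i = begin
    sum (λ j → B i j * (u j - v j))             ≈⟨ sum-cong-≋ (λ j → x[y-z]≈xy-xz (B i j) (u j) (v j)) ⟩
    sum (λ j → B i j * u j - B i j * v j)       ≈⟨ ∑-distrib-+ (λ j → B i j * u j) (λ j → - (B i j * v j)) ⟩
    (B ⊛ u) i + sum (λ j → - (B i j * v j))     ≈⟨ +-congˡ (∑-neg (λ j → B i j * v j)) ⟩
    (B ⊛ u) i - (B ⊛ v) i                       ∎

  ⊛-⊗-assoc : (B : Matrix m n) (C : Matrix n p) (v : Vector Carrier p) →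
              ∀ i → (B ⊛ C ⊛ v) i ≈ (B ⊗ C ⊛ v) i
  ⊛-⊗-assoc B C v i = begin
    sum (λ j → B i j * sum (λ k → C j k * v k))
      ≈⟨ sum-cong-≋ (λ j → *-distribˡ-sum (B i j) (λ k → C j k * v k)) ⟩
    sum (λ j → sum (λ k → B i j * (C j k * v k)))
      ≈⟨ ∑-comm (λ j k → B i j * (C j k * v k)) ⟩
    sum (λ k → sum (λ j → B i j * (C j k * v k)))
      ≈⟨ sum-cong-≋ (λ k → sum-cong-≋ (λ j → sym (*-assoc (B i j) (C j k) (v k)))) ⟩
    sum (λ k → sum (λ j → B i j * C j k * v k))
      ≈⟨ sum-cong-≋ (λ k → sym (*-distribʳ-sum (v k) (λ j → B i j * C j k))) ⟩
    sum (λ k → (B ⊗ C) i k * v k) ∎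

  ⊛-injective : (B : Matrix m n) → TrivialKernel B → {u v : Vector Carrier n} →
                (∀ i → (B ⊛ u) i ≈ (B ⊛ v) i) → ∀ j → u j ≈ v j
  ⊛-injective B ker {u} {v} Bu≈Bv j =
    x∙y⁻¹≈ε⇒x≈y _ _
      (ker (λ k → u k - v k) (λ i → trans (⊛-distrib-- B u v i) (x≈y⇒x∙y⁻¹≈ε (Bu≈Bv i))) j)

open import Relation.Binary.PropositionalEquality
  using (_≡_; refl; sym; trans; cong; cong₂; module ≡-Reasoning)
open import Defs

module ℚᴸ = MatrixAlgebra ℚP.+-*-commutativeRing
module ℤᴸ = MatrixAlgebra ℤP.+-*-commutativeRing

open ℚᴸ using (_⊛_; _⊗_; unit; StandardVertex)
open ≡-Reasoning

sumℚ≡sum : ∀ {d} (f : Vecℚ d) → sumℚ f ≡ ℚᴸ.sum f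
sumℚ≡sum {zero}  f = refl
sumℚ≡sum {suc d} f = cong (f zero ℚ.+_) (sumℚ≡sum (λ i → f (suc i)))

sumℤ≡sum : ∀ {d} (f : Vecℤ d) → sumℤ f ≡ ℤᴸ.sum f
sumℤ≡sum {zero}  f = refl
sumℤ≡sum {suc d} f = cong (ℤ._+_ (f zero)) (sumℤ≡sum (λ i → f (suc i)))

-- z / 1 is already in normal form, so rewriting with this turns the arithmetic of toℚ
-- into integer arithmetic on numerators.
toℚ≡mkℚ : ∀ z → toℚ z ≡ mkℚ z 0 (coprime-sym (1-coprimeTo ℤ.∣ z ∣))
toℚ≡mkℚ z = ℚP.↥p/↧p≡p _

toℚ-+ : ∀ a b → toℚ (a ℤ.+ b) ≡ toℚ a ℚ.+ toℚ b
toℚ-+ a b rewrite toℚ≡mkℚ a | toℚ≡mkℚ b =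
  ℚP./-cong (sym (cong₂ ℤ._+_ (ℤP.*-identityʳ a) (ℤP.*-identityʳ b))) refl

toℚ-* : ∀ a b → toℚ (a ℤ.* b) ≡ toℚ a ℚ.* toℚ b
toℚ-* a b rewrite toℚ≡mkℚ a | toℚ≡mkℚ b = refl

toℚ-injective : ∀ {a b} → toℚ a ≡ toℚ b → a ≡ b
toℚ-injective {a} {b} eq rewrite toℚ≡mkℚ a | toℚ≡mkℚ b = cong ↥_ eq

toℚ-sumℤ : ∀ {d} (f : Vecℤ d) → toℚ (sumℤ f) ≡ sumℚ (λ i → toℚ (f i))
toℚ-sumℤ {zero}  f = refl
toℚ-sumℤ {suc d} f =
  trans (toℚ-+ (f zero) _) (cong (toℚ (f zero) ℚ.+_) (toℚ-sumℤ (λ i → f (suc i))))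

toℚᴹ : ∀ {d} → Matℤ d → ℚᴸ.Matrix d d
toℚᴹ A i j = toℚ (A i j)

·ℚ≡⊛ : ∀ {d} (A : Matℤ d) (v : Vecℚ d) → ∀ i → (A ·ℚ v) i ≡ (toℚᴹ A ⊛ v) i
·ℚ≡⊛ A v i = sumℚ≡sum (λ j → toℚ (A i j) ℚ.* v j)

toℚ-·ℤ : ∀ {d} (A : Matℤ d) (x : Vecℤ d) →
         ∀ i → toℚ ((A ·ℤ x) i) ≡ (toℚᴹ A ⊛ (λ j → toℚ (x j))) i
toℚ-·ℤ A x i = begin
  toℚ (sumℤ (λ j → A i j ℤ.* x j))          ≡⟨ toℚ-sumℤ (λ j → A i j ℤ.* x j) ⟩
  sumℚ (λ j → toℚ (A i j ℤ.* x j))          ≡⟨ sumℚ≡sum (λ j → toℚ (A i j ℤ.* x j)) ⟩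
  ℚᴸ.sum (λ j → toℚ (A i j ℤ.* x j))        ≡⟨ ℚᴸ.sum-cong-≋ (λ j → toℚ-* (A i j) (x j)) ⟩
  (toℚᴹ A ⊛ (λ j → toℚ (x j))) i            ∎

invertible⇒trivialKernel : ∀ {d} (A : Matℤ d) → Invertible A → ℚᴸ.TrivialKernel (toℚᴹ A)
invertible⇒trivialKernel A inv v Av≡0 = inv v (λ i → trans (·ℚ≡⊛ A v i) (Av≡0 i))

row∈dualLattice : ∀ {d} (A : Matℤ d) k → InDualLattice A (λ j → A k j)
row∈dualLattice A k =
  ℤᴸ.unit k , λ j → trans (sumℤ≡sum (λ i → A i j ℤ.* ℤᴸ.unit k i)) (ℤᴸ.∑-*-unit (λ i → A i j) k)

⊆Γ⇒factorization : ∀ {d} (A A' : Matℤ d) → A ⊆Γ A' →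
                   Σ (Matℤ d) λ M → ∀ k j → (toℚᴹ M ⊗ toℚᴹ A') k j ≡ toℚ (A k j)
⊆Γ⇒factorization {d} A A' A⊆A' = M , factorization
  where
  M : Matℤ d
  M k = proj₁ (A⊆A' _ (row∈dualLattice A k))

  factorization : ∀ k j → (toℚᴹ M ⊗ toℚᴹ A') k j ≡ toℚ (A k j)
  factorization k j = begin
    ℚᴸ.sum (λ i → toℚ (M k i) ℚ.* toℚ (A' i j))   ≡⟨ ℚᴸ.sum-cong-≋ (λ i → ℚP.*-comm (toℚ (M k i)) _) ⟩
    (toℚᴹ (transpose A') ⊛ (λ i → toℚ (M k i))) j ≡⟨ toℚ-·ℤ (transpose A') (M k) j ⟨
    toℚ ((transpose A' ·ℤ M k) j)                 ≡⟨ cong toℚ (proj₂ (A⊆A' _ (row∈dualLattice A k)) j) ⟩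
    toℚ (A k j)                                   ∎

vertex⇒standardVertex : ∀ {d} {A : Matℤ d} → Invertible A → {λv : Vecℚ d} {z : Vecℤ d} →
                        (∀ k → (A ·ℚ λv) k ≡ toℚ (z k)) → IsVertex A z → StandardVertex λv
vertex⇒standardVertex inv Aλ≡z (inj₁ z≡0) =
  inj₁ (inv _ (λ k → trans (Aλ≡z k) (cong toℚ (z≡0 k))))
vertex⇒standardVertex {A = A} inv {λv} {z} Aλ≡z (inj₂ (j , z≡Aeⱼ)) =
  inj₂ (j , ℚᴸ.⊛-injective (toℚᴹ A) (invertible⇒trivialKernel A inv) Aλ≡Aeⱼ)
  where
  Aλ≡Aeⱼ : ∀ k → (toℚᴹ A ⊛ λv) k ≡ (toℚᴹ A ⊛ unit j) k
  Aλ≡Aeⱼ k = begin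
    (toℚᴹ A ⊛ λv) k     ≡⟨ ·ℚ≡⊛ A λv k ⟨
    (A ·ℚ λv) k         ≡⟨ Aλ≡z k ⟩
    toℚ (z k)           ≡⟨ cong toℚ (z≡Aeⱼ k) ⟩
    toℚ (A k j)         ≡⟨ ℚᴸ.⊛-unit (toℚᴹ A) j k ⟨
    (toℚᴹ A ⊛ unit j) k ∎

standardVertex⇒vertex : ∀ {d} (A : Matℤ d) {λv : Vecℚ d} {x : Vecℤ d} →
                        (∀ i → (A ·ℚ λv) i ≡ toℚ (x i)) → StandardVertex λv → IsVertex A x
standardVertex⇒vertex A {λv} {x} Aλ≡x (inj₁ λ≡0) = inj₁ λ i → toℚ-injective (begin
  toℚ (x i)                                ≡⟨ Aλ≡x i ⟨
  (A ·ℚ λv) i                              ≡⟨ ·ℚ≡⊛ A λv i ⟩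
  (toℚᴹ A ⊛ λv) i                          ≡⟨ ℚᴸ.⊛-congʳ (toℚᴹ A) λ≡0 i ⟩
  (toℚᴹ A ⊛ replicate _ 0ℚ) i              ≡⟨ ℚᴸ.⊛-zeroʳ (toℚᴹ A) i ⟩
  0ℚ                                       ∎)
standardVertex⇒vertex A {λv} {x} Aλ≡x (inj₂ (j , λ≡eⱼ)) = inj₂ (j , λ i → toℚ-injective (begin
  toℚ (x i)              ≡⟨ Aλ≡x i ⟨
  (A ·ℚ λv) i            ≡⟨ ·ℚ≡⊛ A λv i ⟩
  (toℚᴹ A ⊛ λv) i        ≡⟨ ℚᴸ.⊛-congʳ (toℚᴹ A) λ≡eⱼ i ⟩
  (toℚᴹ A ⊛ unit j) i    ≡⟨ ℚᴸ.⊛-unit (toℚᴹ A) j i ⟩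
  toℚ (A i j)            ∎))

lemma3p1 : (d : ℕ) (A A' : Matℤ d) → Invertible A → Invertible A' → A ⊆Γ A' → Empty A → Empty A'
lemma3p1 d A A' invA _ A⊆A' emptyA x (λv , λ≥0 , ∑λ≤1 , A'λ≡x) =
  standardVertex⇒vertex A' A'λ≡x
    (vertex⇒standardVertex invA Aλ≡Mx (emptyA (M ·ℤ x) (λv , λ≥0 , ∑λ≤1 , Aλ≡Mx)))
  where
  M : Matℤ d
  M = proj₁ (⊆Γ⇒factorization A A' A⊆A')

  MA'≡A : ∀ k j → (toℚᴹ M ⊗ toℚᴹ A') k j ≡ toℚ (A k j)
  MA'≡A = proj₂ (⊆Γ⇒factorization A A' A⊆A')

  Aλ≡Mx : ∀ k → (A ·ℚ λv) k ≡ toℚ ((M ·ℤ x) k)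
  Aλ≡Mx k = begin
    (A ·ℚ λv) k
      ≡⟨ ·ℚ≡⊛ A λv k ⟩
    (toℚᴹ A ⊛ λv) k
      ≡⟨ ℚᴸ.⊛-congˡ (toℚᴹ A) (toℚᴹ M ⊗ toℚᴹ A') (λ i j → sym (MA'≡A i j)) λv k ⟩
    (toℚᴹ M ⊗ toℚᴹ A' ⊛ λv) k
      ≡⟨ ℚᴸ.⊛-⊗-assoc (toℚᴹ M) (toℚᴹ A') λv k ⟨
    (toℚᴹ M ⊛ toℚᴹ A' ⊛ λv) k
      ≡⟨ ℚᴸ.⊛-congʳ (toℚᴹ M) (λ i → trans (sym (·ℚ≡⊛ A' λv i)) (A'λ≡x i)) k ⟩
    (toℚᴹ M ⊛ (λ i → toℚ (x i))) k
      ≡⟨ toℚ-·ℤ M x k ⟨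
    toℚ ((M ·ℤ x) k)
      ∎
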